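{- Let $(\mathcal S,\mathcal O(T))$ be an oriented Steiner triple system with associated Steiner product $\times:\mathbb R^{\mathcal S}\times\mathbb R^{\mathcal S}\to\mathbb R^{\mathcal S}$. Then for all $\mathbf a,\mathbf b\in\mathbb R^{\mathcal S}$, $\mathbf a\cdot(\mathbf a\times\mathbf b)=\mathbf b\cdot(\mathbf a\times\mathbf b)=0$.
   Context: A Steiner triple system $(\mathcal S,T)$: a finite set $\mathcal S$ with a collection $T$ of 3-element subsets such that every 2-element subset lies in exactly one member of $T$. An orientation assigns each triple a cyclic ordering $[a,b,c]$ ($a\to b\to c\to a$, so $[a,b,c]=[b,c,a]=[c,a,b]$). The orientation function $f:\mathcal S\times\mathcal S\to\{ -1,0,1\}$ has $f(s,s)=0$ and, for distinct $s,s'$ with $\{s,s',s''\}\in T$, $f(s,s')=1$ if $[s,s',s'']$ is the chosen orientation and $-1$ otherwise. $\mathbb R^{\mathcal S}$ is the real vector space with basis $\mathcal S$, with inner product $\cdot$ making $\mathcal S$ orthonormal. The Steiner product is the bilinear map with $s\times s=0$ and $s\times s'=f(s,s')s''$ for distinct $s,s'$ in the triple $\{s,s',s''\}$. -}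

module Defs where

open import Level using (Level)
open import Data.Nat using (ℕ; zero; suc)
open import Data.Fin using (Fin; zero; suc)
open import Data.Fin.Properties using (_≟_)
open import Data.Product using (_×_; _,_)
open import Data.Sum using (_⊎_)
open import Data.Bool using (Bool; true; false; if_then_else_; _∧_)
open import Data.Maybe using (Maybe; just; nothing)
open import Data.List using (List; []; _∷_; filter; length)
open import Data.List.Relation.Unary.All using (All)
open import Relation.Nullary using (Dec; ¬_; does)
open import Relation.Nullary.Decidable using (_⊎-dec_; _×-dec_)
open import Relation.Binary.PropositionalEquality using (_≡_; _≢_)
open import Algebra.Bundles using (CommutativeRing)

-- The point set S is Fin n.  A triple (a , b , c) in the list T stands
-- for the triple {a,b,c} together with its chosen orientation [a,b,c].

Triple : ℕ → Set
Triple n = Fin n × Fin n × Fin n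

_∈ᵗ_ : ∀ {n} → Fin n → Triple n → Set
x ∈ᵗ (a , b , c) = x ≡ a ⊎ x ≡ b ⊎ x ≡ c

_∈ᵗ?_ : ∀ {n} (x : Fin n) (t : Triple n) → Dec (x ∈ᵗ t)
x ∈ᵗ? (a , b , c) = (x ≟ a) ⊎-dec ((x ≟ b) ⊎-dec (x ≟ c))

PairIn : ∀ {n} → Fin n → Fin n → Triple n → Set
PairIn x y t = x ∈ᵗ t × y ∈ᵗ t

PairIn? : ∀ {n} (x y : Fin n) (t : Triple n) → Dec (PairIn x y t)
PairIn? x y t = (x ∈ᵗ? t) ×-dec (y ∈ᵗ? t)

Distinct3 : ∀ {n} → Triple n → Set
Distinct3 (a , b , c) = a ≢ b × b ≢ c × a ≢ c

-- T (an oriented family of triples) is a Steiner triple system on Fin n: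
-- all members are 3-element subsets and every 2-element subset {x,y}
-- lies in exactly one member of T (counted with multiplicity in the list,
-- so in particular no 3-set occurs twice).
record IsSTS {n : ℕ} (T : List (Triple n)) : Set where
  field
    distinct   : All Distinct3 T
    exactlyOne : ∀ (x y : Fin n) → x ≢ y →
                 length (filter (PairIn? x y) T) ≡ 1

data Sign : Set where
  pos neg : Sign

-- if {s,s'} ⊆ t, report whether s → s' in the cyclic order of t, and
-- the third point of t
matchT : ∀ {n} → Triple n → Fin n → Fin n → Maybe (Sign × Fin n)
matchT (a , b , c) s s' =
  if does (s ≟ a) ∧ does (s' ≟ b) then just (pos , c) else
  if does (s ≟ b) ∧ does (s' ≟ c) then just (pos , a) else
  if does (s ≟ c) ∧ does (s' ≟ a) then just (pos , b) else
  if does (s ≟ b) ∧ does (s' ≟ a) then just (neg , c) else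
  if does (s ≟ c) ∧ does (s' ≟ b) then just (neg , a) else
  if does (s ≟ a) ∧ does (s' ≟ c) then just (neg , b) else
  nothing

findT : ∀ {n} → List (Triple n) → Fin n → Fin n → Maybe (Sign × Fin n)
findT [] s s' = nothing
findT (t ∷ T) s s' with matchT t s s'
... | just r  = just r
... | nothing = findT T s s'

data Orient : Set where
  -1ₒ 0ₒ +1ₒ : Orient

orient : ∀ {n} → List (Triple n) → Fin n → Fin n → Orient
orient T s s' with does (s ≟ s')
... | true  = 0ₒ
... | false with findT T s s'
...   | just (pos , _) = +1ₒ
...   | just (neg , _) = -1ₒ
...   | nothing        = 0ₒ   -- does not occur in a Steiner triple system

third : ∀ {n} → List (Triple n) → Fin n → Fin n → Maybe (Fin n)
third T s s' with findT T s s'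
... | just (_ , z) = just z
... | nothing      = nothing

module _ {c ℓ : Level} (R : CommutativeRing c ℓ) where
  open CommutativeRing R using (Carrier; _+_; _*_; -_; 0#; 1#)

  ⟦_⟧ₒ : Orient → Carrier
  ⟦ -1ₒ ⟧ₒ = - 1#
  ⟦ 0ₒ ⟧ₒ  = 0#
  ⟦ +1ₒ ⟧ₒ = 1#

  Σ[_] : ∀ {n} → (Fin n → Carrier) → Carrier
  Σ[_] {zero}  v = 0#
  Σ[_] {suc n} v = v zero + Σ[ (λ i → v (suc i)) ]

  dot : ∀ {n} → (Fin n → Carrier) → (Fin n → Carrier) → Carrier
  dot a b = Σ[ (λ u → a u * b u) ]

  basis : ∀ {n} → Maybe (Fin n) → Fin n → Carrier
  basis (just z) u = if does (u ≟ z) then 1# else 0#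
  basis nothing  u = 0#

  basisProd : ∀ {n} → List (Triple n) → Fin n → Fin n → Fin n → Carrier
  basisProd T s s' u = ⟦ orient T s s' ⟧ₒ * basis (third T s s') u

  cross : ∀ {n} → List (Triple n) → (Fin n → Carrier) → (Fin n → Carrier) → Fin n → Carrier
  cross T a b u = Σ[ (λ s → Σ[ (λ s' → (a s * b s') * basisProd T s s' u) ]) ]

-- Write x × y = Σ_z W x y z · z.  The structure constant W is alternating: it vanishes
-- when two of its arguments coincide, and it changes sign when two arguments are swapped,
-- because the triple through {x, y} is unique and read in the opposite cyclic direction
-- it carries the opposite sign.  Hence c · (a × b) = Σ a_x b_y c_z W x y z is an
-- alternating trilinear form, which vanishes for c = a and for c = b: its terms cancel
-- in pairs and the diagonal terms are zero.
module Submission where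

open import Defs
open import Level using (Level)
open import Data.Nat using (ℕ; zero; suc; _≤_; s≤s; z≤n)
open import Data.Nat.Properties using (≤-refl; ≤-reflexive; ≤-trans; m≤n⇒m≤1+n)
open import Data.Fin using (Fin; zero; suc)
open import Data.Fin.Properties using (_≟_)
open import Data.Product using (_×_; _,_; proj₁; proj₂; ∃)
open import Data.Sum using (_⊎_; inj₁; inj₂)
open import Data.Bool using (true; false; _∧_)
open import Data.Maybe using (just; nothing)
open import Data.Maybe.Properties using (just-injective)
open import Data.List using (List; _∷_; filter; length)
open import Data.List.Properties using (filter-accept)
open import Data.List.Relation.Unary.All as All using (All; _∷_)
open import Data.List.Relation.Unary.Any as Any using (Any; here; there)
open import Data.Empty using (⊥-elim)
open import Function using (_∘_; case_of_)
open import Relation.Nullary using (Dec; yes; no; ¬_; does)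
open import Relation.Nullary.Decidable using (dec-true; dec-false)
open import Relation.Binary.PropositionalEquality using (_≡_; _≢_; refl; sym; trans; cong; cong₂)
open import Algebra.Bundles using (CommutativeRing)

opposite : Sign → Sign
opposite pos = neg
opposite neg = pos

data Arranged {n : ℕ} : Sign → Triple n → Fin n → Fin n → Fin n → Set where
  abc : ∀ {a b c} → Arranged pos (a , b , c) a b c
  bca : ∀ {a b c} → Arranged pos (a , b , c) b c a
  cab : ∀ {a b c} → Arranged pos (a , b , c) c a b
  bac : ∀ {a b c} → Arranged neg (a , b , c) b a c
  cba : ∀ {a b c} → Arranged neg (a , b , c) c b a
  acb : ∀ {a b c} → Arranged neg (a , b , c) a c b

module _ {n : ℕ} {σ : Sign} {t : Triple n} {x y z : Fin n} where

  arranged-swap₁₃ : Arranged σ t x y z → Arranged (opposite σ) t z y x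
  arranged-swap₁₃ abc = cba
  arranged-swap₁₃ bca = acb
  arranged-swap₁₃ cab = bac
  arranged-swap₁₃ bac = cab
  arranged-swap₁₃ cba = abc
  arranged-swap₁₃ acb = bca

  arranged-swap₂₃ : Arranged σ t x y z → Arranged (opposite σ) t x z y
  arranged-swap₂₃ abc = acb
  arranged-swap₂₃ bca = bac
  arranged-swap₂₃ cab = cba
  arranged-swap₂₃ bac = bca
  arranged-swap₂₃ cba = cab
  arranged-swap₂₃ acb = abc

  arranged-pairIn : Arranged σ t x y z → PairIn x y t
  arranged-pairIn abc = inj₁ refl , inj₂ (inj₁ refl)
  arranged-pairIn bca = inj₂ (inj₁ refl) , inj₂ (inj₂ refl)
  arranged-pairIn cab = inj₂ (inj₂ refl) , inj₁ refl
  arranged-pairIn bac = inj₂ (inj₁ refl) , inj₁ refl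
  arranged-pairIn cba = inj₂ (inj₂ refl) , inj₂ (inj₁ refl)
  arranged-pairIn acb = inj₁ refl , inj₂ (inj₂ refl)

  arranged-distinct : Distinct3 t → Arranged σ t x y z → x ≢ y × y ≢ z × x ≢ z
  arranged-distinct (a≢b , b≢c , a≢c) abc = a≢b , b≢c , a≢c
  arranged-distinct (a≢b , b≢c , a≢c) bca = b≢c , a≢c ∘ sym , a≢b ∘ sym
  arranged-distinct (a≢b , b≢c , a≢c) cab = a≢c ∘ sym , a≢b , b≢c ∘ sym
  arranged-distinct (a≢b , b≢c , a≢c) bac = a≢b ∘ sym , a≢c , b≢c
  arranged-distinct (a≢b , b≢c , a≢c) cba = b≢c ∘ sym , a≢b ∘ sym , a≢c ∘ sym
  arranged-distinct (a≢b , b≢c , a≢c) acb = a≢c , b≢c ∘ sym , a≢b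

does-∧-true : ∀ {P Q : Set} (p? : Dec P) (q? : Dec Q) → does p? ∧ does q? ≡ true → P × Q
does-∧-true (yes p) (yes q) _ = p , q
does-∧-true (yes _) (no _)  ()
does-∧-true (no _)  _       ()

matchT-sound : ∀ {n} {t : Triple n} {x y σ z} → matchT t x y ≡ just (σ , z) → Arranged σ t x y z
matchT-sound {t = a , b , c} {x} {y} eq
  with does (x ≟ a) ∧ does (y ≟ b) in e₁ | does (x ≟ b) ∧ does (y ≟ c) in e₂
     | does (x ≟ c) ∧ does (y ≟ a) in e₃ | does (x ≟ b) ∧ does (y ≟ a) in e₄
     | does (x ≟ c) ∧ does (y ≟ b) in e₅ | does (x ≟ a) ∧ does (y ≟ c) in e₆
... | true  | _     | _     | _     | _     | _
  with refl ← eq | refl , refl ← does-∧-true (x ≟ a) (y ≟ b) e₁ = abc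
... | false | true  | _     | _     | _     | _
  with refl ← eq | refl , refl ← does-∧-true (x ≟ b) (y ≟ c) e₂ = bca
... | false | false | true  | _     | _     | _
  with refl ← eq | refl , refl ← does-∧-true (x ≟ c) (y ≟ a) e₃ = cab
... | false | false | false | true  | _     | _
  with refl ← eq | refl , refl ← does-∧-true (x ≟ b) (y ≟ a) e₄ = bac
... | false | false | false | false | true  | _
  with refl ← eq | refl , refl ← does-∧-true (x ≟ c) (y ≟ b) e₅ = cba
... | false | false | false | false | false | true
  with refl ← eq | refl , refl ← does-∧-true (x ≟ a) (y ≟ c) e₆ = acb

matchT-complete : ∀ {n} {t : Triple n} {σ x y z} → Distinct3 t → Arranged σ t x y z →
                  matchT t x y ≡ just (σ , z)
matchT-complete {t = a , b , c} _ abc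
  rewrite dec-true (a ≟ a) refl | dec-true (b ≟ b) refl = refl
matchT-complete {t = a , b , c} (a≢b , _ , _) bca
  rewrite dec-false (b ≟ a) (a≢b ∘ sym) | dec-true (b ≟ b) refl | dec-true (c ≟ c) refl = refl
matchT-complete {t = a , b , c} (_ , b≢c , a≢c) cab
  rewrite dec-false (c ≟ a) (a≢c ∘ sym) | dec-false (c ≟ b) (b≢c ∘ sym)
        | dec-true (c ≟ c) refl | dec-true (a ≟ a) refl = refl
matchT-complete {t = a , b , c} (a≢b , b≢c , a≢c) bac
  rewrite dec-false (b ≟ a) (a≢b ∘ sym) | dec-true (b ≟ b) refl | dec-false (a ≟ c) a≢c
        | dec-false (b ≟ c) b≢c | dec-true (a ≟ a) refl = refl
matchT-complete {t = a , b , c} (a≢b , b≢c , a≢c) cba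
  rewrite dec-false (c ≟ a) (a≢c ∘ sym) | dec-false (c ≟ b) (b≢c ∘ sym) | dec-true (c ≟ c) refl
        | dec-false (b ≟ a) (a≢b ∘ sym) | dec-true (b ≟ b) refl = refl
matchT-complete {t = a , b , c} (a≢b , b≢c , a≢c) acb
  rewrite dec-true (a ≟ a) refl | dec-false (c ≟ b) (b≢c ∘ sym) | dec-false (a ≟ b) a≢b
        | dec-false (a ≟ c) a≢c | dec-true (c ≟ c) refl = refl

-- Oriented T σ x y z says that x × y = ± z, with sign + exactly when σ = pos.
Oriented : ∀ {n} → List (Triple n) → Sign → Fin n → Fin n → Fin n → Set
Oriented T σ x y z = Any (λ t → Arranged σ t x y z) T

module _ {n : ℕ} {T : List (Triple n)} {σ : Sign} {x y z : Fin n} where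

  oriented-swap₁₃ : Oriented T σ x y z → Oriented T (opposite σ) z y x
  oriented-swap₁₃ = Any.map arranged-swap₁₃

  oriented-swap₂₃ : Oriented T σ x y z → Oriented T (opposite σ) x z y
  oriented-swap₂₃ = Any.map arranged-swap₂₃

oriented-distinct : ∀ {n} {T : List (Triple n)} {σ x y z} → All Distinct3 T → Oriented T σ x y z →
                    x ≢ y × y ≢ z × x ≢ z
oriented-distinct D o = All.lookupWith arranged-distinct D o

module _ {n : ℕ} {P : Triple n → Set} (P? : ∀ t → Dec (P t)) where

  length-filter-∷ : ∀ t T → length (filter P? T) ≤ length (filter P? (t ∷ T))
  length-filter-∷ t T with P? t
  ... | yes _ = m≤n⇒m≤1+n ≤-refl
  ... | no  _ = ≤-refl

  length-filter-any : ∀ {T} → Any P T → 1 ≤ length (filter P? T)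
  length-filter-any {t ∷ T} (here p) rewrite filter-accept P? {xs = T} p = s≤s z≤n
  length-filter-any {t ∷ T} (there p) = ≤-trans (length-filter-any p) (length-filter-∷ t T)

  length-filter-twice : ∀ {t T} → P t → Any P T → 2 ≤ length (filter P? (t ∷ T))
  length-filter-twice {T = T} p q rewrite filter-accept P? {xs = T} p = s≤s (length-filter-any q)

findT-sound : ∀ {n} (T : List (Triple n)) {x y σ z} → findT T x y ≡ just (σ , z) → Oriented T σ x y z
findT-sound (t ∷ T) {x} {y} eq with matchT t x y in e
... | just _ with refl ← eq = here (matchT-sound e)
... | nothing = there (findT-sound T eq)

-- If a triple before the oriented one also contained {x, y}, the pair would be counted twice.
findT-complete : ∀ {n} {T : List (Triple n)} {x y σ z} → All Distinct3 T →
                 length (filter (PairIn? x y) T) ≤ 1 → Oriented T σ x y z → findT T x y ≡ just (σ , z)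
findT-complete (d ∷ _) _ (here arr) rewrite matchT-complete d arr = refl
findT-complete {T = t ∷ T} {x} {y} (_ ∷ D) once (there o) with matchT t x y in e
... | just _ with s≤s () ← ≤-trans (length-filter-twice (PairIn? x y) (arranged-pairIn (matchT-sound e))
                                                                       (Any.map arranged-pairIn o)) once
... | nothing = findT-complete D (≤-trans (length-filter-∷ (PairIn? x y) t T) once) o

module _ {n : ℕ} {T : List (Triple n)} (sts : IsSTS T) where
  open IsSTS sts

  findT-oriented : ∀ {σ x y z} → Oriented T σ x y z → findT T x y ≡ just (σ , z)
  findT-oriented {x = x} {y} o =
    findT-complete distinct (≤-reflexive (exactlyOne x y (proj₁ (oriented-distinct distinct o)))) o

  oriented? : ∀ x y z → (∃ λ σ → Oriented T σ x y z) ⊎ (∀ σ → ¬ Oriented T σ x y z)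
  oriented? x y z with findT T x y in e
  ... | nothing = inj₂ λ _ o → case trans (sym e) (findT-oriented o) of λ ()
  ... | just (σ , w) with w ≟ z
  ...   | yes refl = inj₁ (σ , findT-sound T e)
  ...   | no w≢z = inj₂ λ _ o → w≢z (cong proj₂ (just-injective (trans (sym e) (findT-oriented o))))

signₒ : Sign → Orient
signₒ pos = +1ₒ
signₒ neg = -1ₒ

orient-findT : ∀ {n} (T : List (Triple n)) {x y σ z} → x ≢ y → findT T x y ≡ just (σ , z) →
               orient T x y ≡ signₒ σ
orient-findT T {x} {y} {pos} x≢y e rewrite dec-false (x ≟ y) x≢y | e = refl
orient-findT T {x} {y} {neg} x≢y e rewrite dec-false (x ≟ y) x≢y | e = refl

third-findT : ∀ {n} (T : List (Triple n)) {x y σ z} → findT T x y ≡ just (σ , z) → third T x y ≡ just z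
third-findT T e rewrite e = refl

module _ {c ℓ : Level} (R : CommutativeRing c ℓ) where
  open CommutativeRing R hiding (zero) renaming (refl to ≈-refl; sym to ≈-sym; trans to ≈-trans)
  open import Algebra.Properties.Ring ring using (-‿involutive; -0#≈0#; -‿distribʳ-*)
  open import Algebra.Properties.CommutativeSemigroup *-commutativeSemigroup
    using (x∙yz≈yx∙z; xy∙z≈zy∙x; xy∙z≈xz∙y)
  open import Algebra.Properties.Semiring.Sum semiring
    using (sum; sum-syntax; ∑-comm; ∑-distrib-+; *-distribˡ-sum; sum-cong-≋; sum-cong-≗; sum-replicate-zero)
  open import Relation.Binary.Reasoning.Setoid setoid

  ∑-zero : ∀ {n} {f : Fin n → Carrier} → (∀ i → f i ≈ 0#) → sum f ≈ 0#
  ∑-zero {n} f≈0 = ≈-trans (sum-cong-≋ f≈0) (sum-replicate-zero n)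

  -- The diagonal hypothesis is not implied by the other one when 2 is not invertible in R.
  ∑∑-antisymmetric : ∀ {n} (H : Fin n → Fin n → Carrier) → (∀ i → H i i ≈ 0#) →
                     (∀ i j → H i j + H j i ≈ 0#) → ∑[ i < n ] ∑[ j < n ] H i j ≈ 0#
  ∑∑-antisymmetric {zero}  H diag anti = ≈-refl
  ∑∑-antisymmetric {suc n} H diag anti = begin
    (H zero zero + row) + ∑[ i < n ] (H (suc i) zero + ∑[ j < n ] H (suc i) (suc j))
      ≈⟨ +-congˡ (∑-distrib-+ (λ i → H (suc i) zero) _) ⟩
    (H zero zero + row) + (column + rest)
      ≈⟨ +-assoc _ _ _ ⟩
    H zero zero + (row + (column + rest))
      ≈⟨ +-congˡ (+-assoc _ _ _) ⟨
    H zero zero + ((row + column) + rest)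
      ≈⟨ +-cong (diag zero) (+-cong border inner) ⟩
    0# + (0# + 0#)
      ≈⟨ ≈-trans (+-identityˡ _) (+-identityˡ _) ⟩
    0# ∎
    where
    row    = ∑[ j < n ] H zero (suc j)
    column = ∑[ i < n ] H (suc i) zero
    rest   = ∑[ i < n ] ∑[ j < n ] H (suc i) (suc j)

    border : row + column ≈ 0#
    border = ≈-trans (≈-sym (∑-distrib-+ (H zero ∘ suc) (λ i → H (suc i) zero)))
                     (∑-zero (λ j → anti zero (suc j)))

    inner : rest ≈ 0#
    inner = ∑∑-antisymmetric (λ i j → H (suc i) (suc j)) (diag ∘ suc) (λ i j → anti (suc i) (suc j))

  cancel-pair : ∀ {k k′ w w′} → k′ ≈ k → w′ ≈ - w → k * w + k′ * w′ ≈ 0#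
  cancel-pair {k} {k′} {w} {w′} k′≈k w′≈-w = begin
    k * w + k′ * w′    ≈⟨ +-congˡ (*-cong k′≈k w′≈-w) ⟩
    k * w + k * - w    ≈⟨ +-congˡ (-‿distribʳ-* k w) ⟨
    k * w + - (k * w)  ≈⟨ -‿inverseʳ _ ⟩
    0#                 ∎

  tripleProduct : ∀ {n} → (Fin n → Fin n → Fin n → Carrier) → (a b c : Fin n → Carrier) → Carrier
  tripleProduct {n} W a b c = ∑[ x < n ] ∑[ y < n ] ∑[ z < n ] ((a x * b y * c z) * W x y z)

  module _ {n : ℕ} {W : Fin n → Fin n → Fin n → Carrier} where

    tripleProduct-alternating₁₃ : (∀ x y z → W z y x ≈ - W x y z) → (∀ x y → W x y x ≈ 0#) →
                                  ∀ a b → tripleProduct W a b a ≈ 0#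
    tripleProduct-alternating₁₃ swap diag a b =
      ≈-trans (∑-comm (λ x y → ∑[ z < n ] H y x z)) (∑-zero λ y →
        ∑∑-antisymmetric (H y) (λ x → ≈-trans (*-congˡ (diag x y)) (zeroʳ _))
                               (λ x z → cancel-pair (xy∙z≈zy∙x (a z) (b y) (a x)) (swap x y z)))
      where
      H : Fin n → Fin n → Fin n → Carrier
      H y x z = (a x * b y * a z) * W x y z

    tripleProduct-alternating₂₃ : (∀ x y z → W x z y ≈ - W x y z) → (∀ x y → W x y y ≈ 0#) →
                                  ∀ a b → tripleProduct W a b b ≈ 0#
    tripleProduct-alternating₂₃ swap diag a b = ∑-zero λ x →
      ∑∑-antisymmetric (H x) (λ y → ≈-trans (*-congˡ (diag x y)) (zeroʳ _))
                             (λ y z → cancel-pair (xy∙z≈xz∙y (a x) (b z) (b y)) (swap x y z))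
      where
      H : Fin n → Fin n → Fin n → Carrier
      H x y z = (a x * b y * b z) * W x y z

  sign : Sign → Carrier
  sign σ = ⟦_⟧ₒ R (signₒ σ)

  sign-opposite : ∀ σ → sign (opposite σ) ≈ - sign σ
  sign-opposite pos = ≈-refl
  sign-opposite neg = ≈-sym (-‿involutive 1#)

  basis-self : ∀ {n} (z : Fin n) → basis R (just z) z ≈ 1#
  basis-self z rewrite dec-true (z ≟ z) refl = ≈-refl

  module _ {n : ℕ} {T : List (Triple n)} where

    basisProd-oriented : IsSTS T → ∀ {σ x y z} → Oriented T σ x y z → basisProd R T x y z ≈ sign σ
    basisProd-oriented sts {σ} {x} {y} {z} o = begin
      ⟦_⟧ₒ R (orient T x y) * basis R (third T x y) z
        ≡⟨ cong₂ (λ f m → ⟦_⟧ₒ R f * basis R m z) (orient-findT T x≢y e) (third-findT T e) ⟩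
      sign σ * basis R (just z) z
        ≈⟨ *-congˡ (basis-self z) ⟩
      sign σ * 1#
        ≈⟨ *-identityʳ _ ⟩
      sign σ ∎
      where
      e = findT-oriented sts o
      x≢y = proj₁ (oriented-distinct (IsSTS.distinct sts) o)

    basisProd-unoriented : ∀ {x y z} → (∀ σ → ¬ Oriented T σ x y z) → basisProd R T x y z ≈ 0#
    basisProd-unoriented {x} {y} {z} unoriented with findT T x y in e
    ... | nothing = zeroʳ _
    ... | just (σ , w) with z ≟ w
    ...   | yes refl = ⊥-elim (unoriented σ (findT-sound T e))
    ...   | no _ = zeroʳ _

    basisProd-reverse : IsSTS T → ∀ {x y z x′ y′ z′} →
                        (∀ {σ} → Oriented T σ x y z → Oriented T (opposite σ) x′ y′ z′) →
                        (∀ {σ} → Oriented T σ x′ y′ z′ → Oriented T (opposite σ) x y z) →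
                        basisProd R T x′ y′ z′ ≈ - basisProd R T x y z
    basisProd-reverse sts {x} {y} {z} forth back with oriented? sts x y z
    ... | inj₁ (σ , o) = begin
      basisProd R T _ _ _     ≈⟨ basisProd-oriented sts (forth o) ⟩
      sign (opposite σ)       ≈⟨ sign-opposite σ ⟩
      - sign σ                ≈⟨ -‿cong (basisProd-oriented sts o) ⟨
      - basisProd R T x y z   ∎
    ... | inj₂ unoriented = begin
      basisProd R T _ _ _     ≈⟨ basisProd-unoriented (λ _ o′ → unoriented _ (back o′)) ⟩
      0#                      ≈⟨ -0#≈0# ⟨
      - 0#                    ≈⟨ -‿cong (basisProd-unoriented unoriented) ⟨
      - basisProd R T x y z   ∎

    basisProd-swap₁₃ : IsSTS T → ∀ x y z → basisProd R T z y x ≈ - basisProd R T x y z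
    basisProd-swap₁₃ sts x y z = basisProd-reverse sts oriented-swap₁₃ oriented-swap₁₃

    basisProd-swap₂₃ : IsSTS T → ∀ x y z → basisProd R T x z y ≈ - basisProd R T x y z
    basisProd-swap₂₃ sts x y z = basisProd-reverse sts oriented-swap₂₃ oriented-swap₂₃

    basisProd-diagonal₁₃ : All Distinct3 T → ∀ x y → basisProd R T x y x ≈ 0#
    basisProd-diagonal₁₃ D x y = basisProd-unoriented λ _ o → proj₂ (proj₂ (oriented-distinct D o)) refl

    basisProd-diagonal₂₃ : All Distinct3 T → ∀ x y → basisProd R T x y y ≈ 0#
    basisProd-diagonal₂₃ D x y = basisProd-unoriented λ _ o → proj₁ (proj₂ (oriented-distinct D o)) refl

  Σ≡sum : ∀ {n} (v : Fin n → Carrier) → Σ[_] R v ≡ sum v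
  Σ≡sum {zero}  v = refl
  Σ≡sum {suc n} v = cong (v zero +_) (Σ≡sum (λ i → v (suc i)))

  dot-cross≈tripleProduct : ∀ {n} (T : List (Triple n)) (a b c : Fin n → Carrier) →
                            dot R c (cross R T a b) ≈ tripleProduct (basisProd R T) a b c
  dot-cross≈tripleProduct {n} T a b c = begin
    dot R c (cross R T a b)
      ≡⟨ dot-as-sum ⟩
    ∑[ z < n ] (c z * ∑[ x < n ] ∑[ y < n ] G z x y)
      ≈⟨ sum-cong-≋ (λ z → ≈-trans (*-distribˡ-sum (c z) (λ x → ∑[ y < n ] G z x y))
                                   (sum-cong-≋ λ x → *-distribˡ-sum (c z) (G z x))) ⟩
    ∑[ z < n ] ∑[ x < n ] ∑[ y < n ] (c z * G z x y)
      ≈⟨ ∑-comm (λ z x → ∑[ y < n ] (c z * G z x y)) ⟩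
    ∑[ x < n ] ∑[ z < n ] ∑[ y < n ] (c z * G z x y)
      ≈⟨ sum-cong-≋ (λ x → ∑-comm (λ z y → c z * G z x y)) ⟩
    ∑[ x < n ] ∑[ y < n ] ∑[ z < n ] (c z * G z x y)
      ≈⟨ sum-cong-≋ (λ x → sum-cong-≋ λ y → sum-cong-≋ λ z → x∙yz≈yx∙z (c z) (a x * b y) (W x y z)) ⟩
    tripleProduct W a b c ∎
    where
    W = basisProd R T

    G : Fin n → Fin n → Fin n → Carrier
    G z x y = (a x * b y) * W x y z

    dot-as-sum : dot R c (cross R T a b) ≡ ∑[ z < n ] (c z * ∑[ x < n ] ∑[ y < n ] G z x y)
    dot-as-sum = trans (Σ≡sum (λ z → c z * cross R T a b z)) (sum-cong-≗ λ z → cong (c z *_)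
                   (trans (Σ≡sum (λ x → Σ[_] R (G z x))) (sum-cong-≗ λ x → Σ≡sum (G z x))))

proposition1 : ∀ {c ℓ : Level} (R : CommutativeRing c ℓ) (n : ℕ) (T : List (Triple n)) →
    IsSTS T →
    ∀ (a b : Fin n → CommutativeRing.Carrier R) →
    CommutativeRing._≈_ R (dot R a (cross R T a b)) (CommutativeRing.0# R) ×
    CommutativeRing._≈_ R (dot R b (cross R T a b)) (CommutativeRing.0# R)
proposition1 R n T sts a b =
    ≈-trans (dot-cross≈tripleProduct R T a b a)
            (tripleProduct-alternating₁₃ R (basisProd-swap₁₃ R sts) (basisProd-diagonal₁₃ R distinct) a b)
  , ≈-trans (dot-cross≈tripleProduct R T a b b)
            (tripleProduct-alternating₂₃ R (basisProd-swap₂₃ R sts) (basisProd-diagonal₂₃ R distinct) a b)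
  where
  open CommutativeRing R using () renaming (trans to ≈-trans)
  open IsSTS sts using (distinct)
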